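{- For all behaviours B1, B1', B2, B2' and B: if B1 [>>] B1', B2 [>>] B2' and B1 [V] B2 == B, then there exists a behaviour B' such that B1' [V] B2' == B' and B [>>] B'.
   Context: Behaviours of the process language SP are given by the grammar B ::= End | p!e @! a; B | p?x @? a; B | p(+)l @+ a; B | p & mB1 // mB2 | If e Then B1 Else B2 | Call X, with mB ::= None | Some (a,B) and labels l in {left, right}; in the branching term p & mB1 // mB2, mB1 is the (optional, annotated) behaviour offered for label left and mB2 the one for label right. The merge relation B1 [V] B2 == B (merge B1 B2 B) is defined inductively: End [V] End == End; Call X [V] Call X == Call X; two send terms (resp. receive, selection terms) with identical prefix merge to that prefix followed by the merge of their continuations; two conditionals with the same guard merge branchwise; two branching terms on the same process p merge label by label: if both offer a label (with the same annotation) the continuations are merged, if only one offers it that offer is kept, if neither offers it the result offers None. No other pairs are mergeable. The branching order B [>>] B' (more_branches) is defined inductively: End [>>] End; Call X [>>] Call X; congruence for send, receive and selection prefixes and for conditionals; and for branching terms p & mBl // mBr [>>] p & None // None, p & mBl // Some (a,Br) [>>] p & None // Some (a,Br') if Br [>>] Br', p & Some (a,Bl) // mBr [>>] p & Some (a,Bl') // None if Bl [>>] Bl', and p & Some (a,Bl) // Some (a',Br) [>>] p & Some (a,Bl') // Some (a',Br') if Bl [>>] Bl' and Br [>>] Br'. Intuitively, B [>>] B' means B offers at least the branches offered by B'. -}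

module Defs where

open import Data.Maybe using (Maybe; just; nothing)
open import Data.Product using (_×_; _,_)

module SP (Pid Expr Var Ann RecVar : Set) where

  data Label : Set where
    left right : Label

  data Behaviour : Set

  MBehaviour : Set
  MBehaviour = Maybe (Ann × Behaviour)

  data Behaviour where
    End    : Behaviour
    Send   : Pid → Expr → Ann → Behaviour → Behaviour
    Recv   : Pid → Var → Ann → Behaviour → Behaviour
    Sel    : Pid → Label → Ann → Behaviour → Behaviour
    Branch : Pid → Maybe (Ann × Behaviour) → Maybe (Ann × Behaviour) → Behaviour
    Cond   : Expr → Behaviour → Behaviour → Behaviour
    Call   : RecVar → Behaviour

  mutual
    data Merge : Behaviour → Behaviour → Behaviour → Set where
      m-end  : Merge End End End
      m-call : ∀ {X} → Merge (Call X) (Call X) (Call X)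
      m-send : ∀ {p e a B1 B2 B} → Merge B1 B2 B →
               Merge (Send p e a B1) (Send p e a B2) (Send p e a B)
      m-recv : ∀ {p x a B1 B2 B} → Merge B1 B2 B →
               Merge (Recv p x a B1) (Recv p x a B2) (Recv p x a B)
      m-sel  : ∀ {p l a B1 B2 B} → Merge B1 B2 B →
               Merge (Sel p l a B1) (Sel p l a B2) (Sel p l a B)
      m-cond : ∀ {e B1 B2 B1' B2' B B'} → Merge B1 B1' B → Merge B2 B2' B' →
               Merge (Cond e B1 B2) (Cond e B1' B2') (Cond e B B')
      m-branch : ∀ {p l1 r1 l2 r2 l r} → MergeM l1 l2 l → MergeM r1 r2 r →
               Merge (Branch p l1 r1) (Branch p l2 r2) (Branch p l r)

    data MergeM : MBehaviour → MBehaviour → MBehaviour → Set where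
      mm-both  : ∀ {a B1 B2 B} → Merge B1 B2 B →
                 MergeM (just (a , B1)) (just (a , B2)) (just (a , B))
      mm-left  : ∀ {a B} → MergeM (just (a , B)) nothing (just (a , B))
      mm-right : ∀ {a B} → MergeM nothing (just (a , B)) (just (a , B))
      mm-none  : MergeM nothing nothing nothing

  data MoreBranches : Behaviour → Behaviour → Set where
    mb-end  : MoreBranches End End
    mb-call : ∀ {X} → MoreBranches (Call X) (Call X)
    mb-send : ∀ {p e a B B'} → MoreBranches B B' →
              MoreBranches (Send p e a B) (Send p e a B')
    mb-recv : ∀ {p x a B B'} → MoreBranches B B' →
              MoreBranches (Recv p x a B) (Recv p x a B')
    mb-sel  : ∀ {p l a B B'} → MoreBranches B B' →
              MoreBranches (Sel p l a B) (Sel p l a B')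
    mb-cond : ∀ {e B1 B2 B1' B2'} → MoreBranches B1 B1' → MoreBranches B2 B2' →
              MoreBranches (Cond e B1 B2) (Cond e B1' B2')
    mb-none : ∀ {p mBl mBr} →
              MoreBranches (Branch p mBl mBr) (Branch p nothing nothing)
    mb-right : ∀ {p mBl a Br Br'} → MoreBranches Br Br' →
              MoreBranches (Branch p mBl (just (a , Br))) (Branch p nothing (just (a , Br')))
    mb-left : ∀ {p a Bl Bl' mBr} → MoreBranches Bl Bl' →
              MoreBranches (Branch p (just (a , Bl)) mBr) (Branch p (just (a , Bl')) nothing)
    mb-both : ∀ {p a a' Bl Bl' Br Br'} → MoreBranches Bl Bl' → MoreBranches Br Br' →
              MoreBranches (Branch p (just (a , Bl)) (just (a' , Br)))
                           (Branch p (just (a , Bl')) (just (a' , Br')))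

module Submission where

open import Defs
open import Data.Product using (∃; _×_; _,_)
open import Data.Maybe using (just; nothing)

-- Merging only ever adds branches, so the merge of two behaviours has more
-- branches than either argument.  Pruning the arguments is then mirrored on the
-- merge label by label: where both pruned sides still offer a label, recurse;
-- where only one does, its pruned continuation is reached from the merged one
-- by transitivity through that argument.

module _ {Pid Expr Var Ann RecVar : Set} where
  open SP Pid Expr Var Ann RecVar

  data MoreOffers : MBehaviour → MBehaviour → Set where
    drop : ∀ {mB} → MoreOffers mB nothing
    keep : ∀ {a B B'} → MoreBranches B B' → MoreOffers (just (a , B)) (just (a , B'))

  data BranchPruning (p : Pid) (l r : MBehaviour) : Behaviour → Set where
    pruned : ∀ {l' r'} → MoreOffers l l' → MoreOffers r r' → BranchPruning p l r (Branch p l' r')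

  branchPruning : ∀ {p l r B'} → MoreBranches (Branch p l r) B' → BranchPruning p l r B'
  branchPruning mb-none         = pruned drop drop
  branchPruning (mb-right br)   = pruned drop (keep br)
  branchPruning (mb-left bl)    = pruned (keep bl) drop
  branchPruning (mb-both bl br) = pruned (keep bl) (keep br)

  MoreBranches-Branch⁺ : ∀ {p l r l' r'} → MoreOffers l l' → MoreOffers r r' →
                         MoreBranches (Branch p l r) (Branch p l' r')
  MoreBranches-Branch⁺ drop      drop      = mb-none
  MoreBranches-Branch⁺ drop      (keep br) = mb-right br
  MoreBranches-Branch⁺ (keep bl) drop      = mb-left bl
  MoreBranches-Branch⁺ (keep bl) (keep br) = mb-both bl br

  mutual
    MoreBranches-refl : (B : Behaviour) → MoreBranches B B
    MoreBranches-refl End            = mb-end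
    MoreBranches-refl (Send _ _ _ B) = mb-send (MoreBranches-refl B)
    MoreBranches-refl (Recv _ _ _ B) = mb-recv (MoreBranches-refl B)
    MoreBranches-refl (Sel _ _ _ B)  = mb-sel (MoreBranches-refl B)
    MoreBranches-refl (Branch _ l r) = MoreBranches-Branch⁺ (MoreOffers-refl l) (MoreOffers-refl r)
    MoreBranches-refl (Cond _ B C)   = mb-cond (MoreBranches-refl B) (MoreBranches-refl C)
    MoreBranches-refl (Call _)       = mb-call

    MoreOffers-refl : (mB : MBehaviour) → MoreOffers mB mB
    MoreOffers-refl nothing        = drop
    MoreOffers-refl (just (_ , B)) = keep (MoreBranches-refl B)

  MoreBranches-trans : ∀ {B B' B''} → MoreBranches B B' → MoreBranches B' B'' → MoreBranches B B''
  MoreBranches-trans mb-end       mb-end       = mb-end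
  MoreBranches-trans mb-call      mb-call      = mb-call
  MoreBranches-trans (mb-send b)  (mb-send c)  = mb-send (MoreBranches-trans b c)
  MoreBranches-trans (mb-recv b)  (mb-recv c)  = mb-recv (MoreBranches-trans b c)
  MoreBranches-trans (mb-sel b)   (mb-sel c)   = mb-sel (MoreBranches-trans b c)
  MoreBranches-trans (mb-cond b₁ b₂) (mb-cond c₁ c₂) =
    mb-cond (MoreBranches-trans b₁ c₁) (MoreBranches-trans b₂ c₂)
  MoreBranches-trans mb-none      mb-none      = mb-none
  MoreBranches-trans (mb-right _) mb-none      = mb-none
  MoreBranches-trans (mb-left _)  mb-none      = mb-none
  MoreBranches-trans (mb-both _ _) mb-none     = mb-none
  MoreBranches-trans (mb-right b) (mb-right c) = mb-right (MoreBranches-trans b c)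
  MoreBranches-trans (mb-left b)  (mb-left c)  = mb-left (MoreBranches-trans b c)
  MoreBranches-trans (mb-both _ b) (mb-right c) = mb-right (MoreBranches-trans b c)
  MoreBranches-trans (mb-both b _) (mb-left c)  = mb-left (MoreBranches-trans b c)
  MoreBranches-trans (mb-both b₁ b₂) (mb-both c₁ c₂) =
    mb-both (MoreBranches-trans b₁ c₁) (MoreBranches-trans b₂ c₂)

  MoreOffers-trans : ∀ {mB mB' mB''} → MoreOffers mB mB' → MoreOffers mB' mB'' → MoreOffers mB mB''
  MoreOffers-trans _        drop     = drop
  MoreOffers-trans (keep b) (keep c) = keep (MoreBranches-trans b c)

  mutual
    Merge-sym : ∀ {B₁ B₂ B} → Merge B₁ B₂ B → Merge B₂ B₁ B
    Merge-sym m-end            = m-end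
    Merge-sym m-call           = m-call
    Merge-sym (m-send m)       = m-send (Merge-sym m)
    Merge-sym (m-recv m)       = m-recv (Merge-sym m)
    Merge-sym (m-sel m)        = m-sel (Merge-sym m)
    Merge-sym (m-cond m n)     = m-cond (Merge-sym m) (Merge-sym n)
    Merge-sym (m-branch ml mr) = m-branch (MergeM-sym ml) (MergeM-sym mr)

    MergeM-sym : ∀ {mB₁ mB₂ mB} → MergeM mB₁ mB₂ mB → MergeM mB₂ mB₁ mB
    MergeM-sym (mm-both m) = mm-both (Merge-sym m)
    MergeM-sym mm-left     = mm-right
    MergeM-sym mm-right    = mm-left
    MergeM-sym mm-none     = mm-none

  mutual
    Merge-moreBranchesʳ : ∀ {B₁ B₂ B} → Merge B₁ B₂ B → MoreBranches B B₂
    Merge-moreBranchesʳ m-end            = mb-end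
    Merge-moreBranchesʳ m-call           = mb-call
    Merge-moreBranchesʳ (m-send m)       = mb-send (Merge-moreBranchesʳ m)
    Merge-moreBranchesʳ (m-recv m)       = mb-recv (Merge-moreBranchesʳ m)
    Merge-moreBranchesʳ (m-sel m)        = mb-sel (Merge-moreBranchesʳ m)
    Merge-moreBranchesʳ (m-cond m n)     = mb-cond (Merge-moreBranchesʳ m) (Merge-moreBranchesʳ n)
    Merge-moreBranchesʳ (m-branch ml mr) =
      MoreBranches-Branch⁺ (MergeM-moreOffersʳ ml) (MergeM-moreOffersʳ mr)

    MergeM-moreOffersʳ : ∀ {mB₁ mB₂ mB} → MergeM mB₁ mB₂ mB → MoreOffers mB mB₂
    MergeM-moreOffersʳ (mm-both m)         = keep (Merge-moreBranchesʳ m)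
    MergeM-moreOffersʳ mm-left             = drop
    MergeM-moreOffersʳ (mm-right {B = B}) = keep (MoreBranches-refl B)
    MergeM-moreOffersʳ mm-none             = drop

  MergeM-moreOffersˡ : ∀ {mB₁ mB₂ mB} → MergeM mB₁ mB₂ mB → MoreOffers mB mB₁
  MergeM-moreOffersˡ m = MergeM-moreOffersʳ (MergeM-sym m)

  mutual
    Merge-prune : ∀ {B₁ B₁' B₂ B₂' B} →
                  MoreBranches B₁ B₁' → MoreBranches B₂ B₂' → Merge B₁ B₂ B →
                  ∃ λ B' → Merge B₁' B₂' B' × MoreBranches B B'
    Merge-prune mb-end  mb-end  m-end  = End , m-end , mb-end
    Merge-prune mb-call mb-call m-call = _ , m-call , mb-call
    Merge-prune (mb-send b₁) (mb-send b₂) (m-send m) with Merge-prune b₁ b₂ m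
    ... | _ , m' , b = _ , m-send m' , mb-send b
    Merge-prune (mb-recv b₁) (mb-recv b₂) (m-recv m) with Merge-prune b₁ b₂ m
    ... | _ , m' , b = _ , m-recv m' , mb-recv b
    Merge-prune (mb-sel b₁) (mb-sel b₂) (m-sel m) with Merge-prune b₁ b₂ m
    ... | _ , m' , b = _ , m-sel m' , mb-sel b
    Merge-prune (mb-cond b₁ c₁) (mb-cond b₂ c₂) (m-cond m n)
      with Merge-prune b₁ b₂ m | Merge-prune c₁ c₂ n
    ... | _ , m' , b | _ , n' , c = _ , m-cond m' n' , mb-cond b c
    Merge-prune b₁ b₂ (m-branch ml mr) with branchPruning b₁ | branchPruning b₂
    ... | pruned bl₁ br₁ | pruned bl₂ br₂ with MergeM-prune bl₁ bl₂ ml | MergeM-prune br₁ br₂ mr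
    ... | _ , ml' , bl | _ , mr' , br = _ , m-branch ml' mr' , MoreBranches-Branch⁺ bl br

    MergeM-prune : ∀ {mB₁ mB₁' mB₂ mB₂' mB} →
                   MoreOffers mB₁ mB₁' → MoreOffers mB₂ mB₂' → MergeM mB₁ mB₂ mB →
                   ∃ λ mB' → MergeM mB₁' mB₂' mB' × MoreOffers mB mB'
    MergeM-prune drop      drop      _           = _ , mm-none , drop
    MergeM-prune (keep b₁) (keep b₂) (mm-both m) with Merge-prune b₁ b₂ m
    ... | _ , m' , b = _ , mm-both m' , keep b
    MergeM-prune drop      o₂@(keep _) m =
      _ , mm-right , MoreOffers-trans (MergeM-moreOffersʳ m) o₂
    MergeM-prune o₁@(keep _) drop      m =
      _ , mm-left , MoreOffers-trans (MergeM-moreOffersˡ m) o₁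

mainTheorem15 : (Pid Expr Var Ann RecVar : Set) →
    let open SP Pid Expr Var Ann RecVar in
    (B1 B1' B2 B2' B : Behaviour) →
    MoreBranches B1 B1' → MoreBranches B2 B2' → Merge B1 B2 B →
    ∃ λ B' → Merge B1' B2' B' × MoreBranches B B'
mainTheorem15 _ _ _ _ _ _ _ _ _ _ = Merge-prune
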